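{- Let $x_0\in\mathbb{N}$. If $L(b;x_1,y_1;x_2,y_2)$ has no bad pair of $2$s whose positions both have first coordinate at least $x_0$, then it has diagonal periodicity after $x_0+\max\{x_1,x_2\}$.
   Context: The Lengyel transfer game $L(b;x_1,y_1;x_2,y_2)$ ($b,x_1,x_2$ positive, $y_1,y_2$ nonnegative integers) is the impartial normal-play game on positions $(x,y)\in\mathbb{N}^2$ in which a move consists of adding one of $(0,-b)$, $(-x_1,y_1)$, $(-x_2,y_2)$, provided the result lies in $\mathbb{N}^2$; $\mathcal{SG}(x,y)$ is the Sprague–Grundy value. Let $\mathcal{SG}^*(x,y)=\mathcal{SG}(x,y)$ if $\mathcal{SG}(x,y)\in\{0,1,2\}$ and $\mathcal{SG}^*(x,y)=2$ if $\mathcal{SG}(x,y)=3$. Positions $(x,y),(x',y')$ form a bad pair of $2$s if $\mathcal{SG}^*(x,y)=\mathcal{SG}^*(x',y')=2$ and $(x-x',y-y')=(x_1-x_2,y_2-y_1)$. The game has diagonal periodicity after $x_0'$ if $\mathcal{SG}^*(x,y)=\mathcal{SG}^*(x+x_1+x_2,\,y-y_1-y_2)$ for all $(x,y)$ with $x\ge x_0'$ and $y\ge y_1+y_2$. -}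

module Defs where

open import Data.Nat using (ℕ; zero; suc; _+_; _∸_; _≤_; _<_; _≤?_; _≡ᵇ_)
open import Data.Nat.Properties using (∸-monoʳ-<)
open import Data.Nat.Induction using (<-rec)
open import Data.Bool using (Bool; true; false; if_then_else_)
open import Data.List using (List; []; _∷_; length)
open import Data.Bool.ListAction using (any)
open import Relation.Nullary using (yes; no)

record Lengyel : Set where
  field
    b x₁ y₁ x₂ y₂ : ℕ
    b>0  : 0 < b
    x₁>0 : 0 < x₁
    x₂>0 : 0 < x₂

-- minimal excludant of a finite list of naturals
-- (the mex is ≤ length l, so searching length l + 1 candidates suffices)
mexFrom : ℕ → ℕ → List ℕ → ℕ
mexFrom zero    k l = k
mexFrom (suc f) k l = if any (λ v → v ≡ᵇ k) l then mexFrom f (suc k) l else k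

mex : List ℕ → ℕ
mex l = mexFrom (length l) 0 l

module _ (G : Lengyel) where
  open Lengyel G

  private
    xOpts : (x y : ℕ) → (∀ {x'} → x' < x → ℕ → ℕ) → List ℕ
    xOpts x y rec = opt x₁ y₁ x₁>0 (opt x₂ y₂ x₂>0 [])
      where
        opt : (dx dy : ℕ) → 0 < dx → List ℕ → List ℕ
        opt dx dy dx>0 rest with dx ≤? x
        ... | yes dx≤x = rec (∸-monoʳ-< {x} {dx} {0} dx>0 dx≤x) (y + dy) ∷ rest
        ... | no  _    = rest

    row : (x : ℕ) → (∀ {x'} → x' < x → ℕ → ℕ) → ℕ → ℕ
    row x rec = <-rec (λ _ → ℕ) step
      where
        step : (y : ℕ) → (∀ {y'} → y' < y → ℕ) → ℕ
        step y recy with b ≤? y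
        ... | yes b≤y = mex (recy (∸-monoʳ-< {y} {b} {0} b>0 b≤y) ∷ xOpts x y rec)
        ... | no  _   = mex (xOpts x y rec)

  -- Sprague–Grundy value 𝒮𝒢(x,y): mex of the values of the positions
  -- reachable by (0,-b), (-x₁,y₁), (-x₂,y₂) that stay in ℕ².
  SG : ℕ → ℕ → ℕ
  SG = <-rec (λ _ → ℕ → ℕ) row

  -- 𝒮𝒢* : 3 ↦ 2, otherwise unchanged (𝒮𝒢 ≤ 3 since there are ≤ 3 options)
  SG* : ℕ → ℕ → ℕ
  SG* x y = if SG x y ≡ᵇ 3 then 2 else SG x y

  -- (x,y),(x',y') form a bad pair of 2s:
  -- 𝒮𝒢* = 2 at both, and (x - x', y - y') = (x₁ - x₂, y₂ - y₁) (over ℤ,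
  -- written additively in ℕ)
  BadPair : ℕ → ℕ → ℕ → ℕ → Set
  BadPair x y x' y' =
    SG* x y ≡ 2 × SG* x' y' ≡ 2 × x + x₂ ≡ x' + x₁ × y + y₁ ≡ y' + y₂
    where open import Data.Product using (_×_)
          open import Relation.Binary.PropositionalEquality using (_≡_)

  DiagPeriodicAfter : ℕ → Set
  DiagPeriodicAfter x₀' = ∀ x y → x₀' ≤ x → y₁ + y₂ ≤ y →
    SG* x y ≡ SG* (x + x₁ + x₂) (y ∸ (y₁ + y₂))
    where open import Relation.Binary.PropositionalEquality using (_≡_)

module Submission where

-- Only the class of a Grundy value matters: 0, 1, or "at least 2".  A position has at most three options,
-- so SG ≤ 3 and SG* is exactly this class; and the class of a mex depends only on whether 0 and 1 occur
-- among the classes of the options.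
-- Moving up by b swaps the classes 0 and 1 and fixes 2 (induction on x, then on y).  Hence the vertical
-- option of (x, y) carries the swapped class of (x, y) itself, and it can only influence the mex when both
-- transfer options have class 2.  Without bad pairs the class of (x, y) is therefore the mex of the classes
-- of (x - x₁, y + y₁) and (x - x₂, y + y₂).  Applying this rule at (x, y), at its diagonal translate
-- (x + x₁ + x₂, y - y₁ - y₂) and at the two positions in between, and using that a position never has the
-- class 0 or 1 of one of its options, a finite case analysis on classes closes the diamond.

open import Defs
open import Data.Nat using (ℕ; _≤_; _+_; _⊔_)
open import Relation.Nullary using (¬_)

open import Data.Bool using (Bool; true; false; _∨_; if_then_else_)
open import Data.Bool.ListAction using (any; or)
open import Data.Bool.Properties using (∨-zeroʳ)
open import Data.Empty using (⊥-elim)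
open import Data.List using (List; []; _∷_; _++_; map; length)
open import Data.List.Membership.Propositional using (_∈_)
open import Data.List.Membership.Propositional.Properties using (∈-++⁺ˡ; ∈-++⁺ʳ)
open import Data.List.Properties using (map-∘; map-cong; map-++; length-++)
open import Data.List.Relation.Unary.Any using (here; there)
open import Data.Nat using (zero; suc; _∸_; _<_; _≡ᵇ_; _≤?_; s≤s; z≤n; _<′_; ≤′-refl; ≤′-step)
open import Data.Nat.Induction using (<′-wellFounded; <′-wellFounded′; <-rec)
open import Data.Nat.Properties
  using ( ≤-refl; ≤-trans; n≤1+n; m≤m+n; m≤n+m; +-suc; +-assoc; +-mono-≤; +-monoʳ-≤; m≤m⊔n; m≤n⊔m
        ; m∸n+n≡m; m+n∸n≡m; m+n≤o⇒m≤o∸n; m+n≤o⇒n≤o; ∸-monoʳ-<; <⇒<′; +-commutativeSemigroup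
        ; module ≤-Reasoning )
open import Algebra.Properties.CommutativeSemigroup +-commutativeSemigroup using (xy∙z≈xz∙y)
open import Data.Product using (_×_; _,_; proj₁; proj₂)
open import Data.Sum using (_⊎_; inj₁; inj₂; [_,_])
open import Function using (_∘_)
open import Relation.Binary.PropositionalEquality
  using (_≡_; _≢_; refl; sym; trans; cong; cong₂; subst; module ≡-Reasoning)
open import Relation.Nullary using (Dec; yes; no)

data Class : Set where
  c₀ c₁ c₂ : Class

class : ℕ → Class
class zero          = c₀
class (suc zero)    = c₁
class (suc (suc _)) = c₂

value : Class → ℕ
value c₀ = 0
value c₁ = 1
value c₂ = 2

c₀≢c₂ : c₀ ≢ c₂
c₀≢c₂ ()

c₁≢c₂ : c₁ ≢ c₂
c₁≢c₂ ()

swap₀₁ : Class → Class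
swap₀₁ c₀ = c₁
swap₀₁ c₁ = c₀
swap₀₁ c₂ = c₂

swap₀₁-involutive : ∀ c → swap₀₁ (swap₀₁ c) ≡ c
swap₀₁-involutive c₀ = refl
swap₀₁-involutive c₁ = refl
swap₀₁-involutive c₂ = refl

_==_ : Class → Class → Bool
c₀ == c₀ = true
c₁ == c₁ = true
c₂ == c₂ = true
_  == _  = false

==-refl : ∀ c → (c == c) ≡ true
==-refl c₀ = refl
==-refl c₁ = refl
==-refl c₂ = refl

swap₀₁-== : ∀ a c → (swap₀₁ a == c) ≡ (a == swap₀₁ c)
swap₀₁-== c₀ c₀ = refl
swap₀₁-== c₀ c₁ = refl
swap₀₁-== c₀ c₂ = refl
swap₀₁-== c₁ c₀ = refl
swap₀₁-== c₁ c₁ = refl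
swap₀₁-== c₁ c₂ = refl
swap₀₁-== c₂ c₀ = refl
swap₀₁-== c₂ c₁ = refl
swap₀₁-== c₂ c₂ = refl

occurs : Class → List Class → Bool
occurs c = any (_== c)

∈⇒occurs : ∀ {c l} → c ∈ l → occurs c l ≡ true
∈⇒occurs {c} {_ ∷ l} (here refl)  = cong (_∨ occurs c l) (==-refl c)
∈⇒occurs {c} {a ∷ _} (there c∈l) = trans (cong ((a == c) ∨_) (∈⇒occurs c∈l)) (∨-zeroʳ _)

occurs-swap₀₁ : ∀ c l → occurs c (map swap₀₁ l) ≡ occurs (swap₀₁ c) l
occurs-swap₀₁ c []      = refl
occurs-swap₀₁ c (a ∷ l) = cong₂ _∨_ (swap₀₁-== a c) (occurs-swap₀₁ c l)

mexᵇ : (occurs₀ occurs₁ : Bool) → Class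
mexᵇ false _     = c₀
mexᵇ true  false = c₁
mexᵇ true  true  = c₂

mexᶜ : List Class → Class
mexᶜ l = mexᵇ (occurs c₀ l) (occurs c₁ l)

mex₂ : Class → Class → Class
mex₂ a b = mexᶜ (a ∷ b ∷ [])

mexᶜ-∉ : ∀ {c l} → c ∈ l → mexᶜ l ≡ c → c ≡ c₂
mexᶜ-∉ {c₂} _ _ = refl
mexᶜ-∉ {c₀} {l} c∈l eq with occurs c₀ l | ∈⇒occurs c∈l | occurs c₁ l
mexᶜ-∉ {c₀} c∈l () | true | refl | false
mexᶜ-∉ {c₀} c∈l () | true | refl | true
mexᶜ-∉ {c₁} {l} c∈l eq with occurs c₀ l | occurs c₁ l | ∈⇒occurs c∈l
mexᶜ-∉ {c₁} c∈l () | false | true | refl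
mexᶜ-∉ {c₁} c∈l () | true  | true | refl

mexᶜ-swap₀₁ : ∀ m l → m ≡ mexᶜ (swap₀₁ m ∷ l) → mexᶜ (m ∷ map swap₀₁ l) ≡ swap₀₁ m
mexᶜ-swap₀₁ m l rewrite occurs-swap₀₁ c₀ l | occurs-swap₀₁ c₁ l = on-occurrences m _ _
  where
  on-occurrences : ∀ m A B → m ≡ mexᵇ ((swap₀₁ m == c₀) ∨ A) ((swap₀₁ m == c₁) ∨ B) →
                   mexᵇ ((m == c₀) ∨ B) ((m == c₁) ∨ A) ≡ swap₀₁ m
  on-occurrences c₀ false _     _  = refl
  on-occurrences c₁ _     false _  = refl
  on-occurrences c₂ true  true  _  = refl
  on-occurrences c₀ true  _     ()
  on-occurrences c₁ _     true  ()
  on-occurrences c₂ false _     ()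
  on-occurrences c₂ true  false ()

mexᶜ-cons-swap₀₁ : ∀ m l → m ≡ mexᶜ l → m ≡ mexᶜ (swap₀₁ m ∷ l)
mexᶜ-cons-swap₀₁ m l = on-occurrences m (occurs c₀ l) (occurs c₁ l)
  where
  on-occurrences : ∀ m A B → m ≡ mexᵇ A B → m ≡ mexᵇ ((swap₀₁ m == c₀) ∨ A) ((swap₀₁ m == c₁) ∨ B)
  on-occurrences c₀ false _     _  = refl
  on-occurrences c₁ true  false _  = refl
  on-occurrences c₂ true  true  _  = refl
  on-occurrences c₀ true  false ()
  on-occurrences c₀ true  true  ()
  on-occurrences c₁ false _     ()
  on-occurrences c₁ true  true  ()
  on-occurrences c₂ false _     ()
  on-occurrences c₂ true  false ()

mexᶜ-ignores-swap₀₁ : ∀ m l → (occurs c₀ l ∨ occurs c₁ l) ≡ true →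
                      m ≡ mexᶜ (swap₀₁ m ∷ l) → m ≡ mexᶜ l
mexᶜ-ignores-swap₀₁ m l = on-occurrences m (occurs c₀ l) (occurs c₁ l)
  where
  on-occurrences : ∀ m A B → (A ∨ B) ≡ true →
                   m ≡ mexᵇ ((swap₀₁ m == c₀) ∨ A) ((swap₀₁ m == c₁) ∨ B) → m ≡ mexᵇ A B
  on-occurrences c₀ false _     _  _  = refl
  on-occurrences c₁ true  false _  _  = refl
  on-occurrences c₂ true  true  _  _  = refl
  on-occurrences c₀ true  _     _  ()
  on-occurrences c₁ false false () _
  on-occurrences c₁ _     true  _  ()
  on-occurrences c₂ false _     _  ()
  on-occurrences c₂ true  false _  ()

occurs₀₁-unless-both-c₂ : ∀ r₁ r₂ → ¬ (r₁ ≡ c₂ × r₂ ≡ c₂) →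
                          (occurs c₀ (r₁ ∷ r₂ ∷ []) ∨ occurs c₁ (r₁ ∷ r₂ ∷ [])) ≡ true
occurs₀₁-unless-both-c₂ c₀ _  _ = refl
occurs₀₁-unless-both-c₂ c₁ c₀ _ = refl
occurs₀₁-unless-both-c₂ c₁ c₁ _ = refl
occurs₀₁-unless-both-c₂ c₁ c₂ _ = refl
occurs₀₁-unless-both-c₂ c₂ c₀ _ = refl
occurs₀₁-unless-both-c₂ c₂ c₁ _ = refl
occurs₀₁-unless-both-c₂ c₂ c₂ not-both = ⊥-elim (not-both (refl , refl))

mex₂-ignores-swap₀₁ : ∀ m r₁ r₂ → ¬ (r₁ ≡ c₂ × r₂ ≡ c₂) →
                      m ≡ mexᶜ (swap₀₁ m ∷ r₁ ∷ r₂ ∷ []) → m ≡ mex₂ r₁ r₂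
mex₂-ignores-swap₀₁ m r₁ r₂ not-both =
  mexᶜ-ignores-swap₀₁ m (r₁ ∷ r₂ ∷ []) (occurs₀₁-unless-both-c₂ r₁ r₂ not-both)

diamond-c₀ : ∀ t u → mex₂ (mex₂ t c₀) (mex₂ c₀ u) ≡ c₀
diamond-c₀ c₀ c₀ = refl
diamond-c₀ c₀ c₁ = refl
diamond-c₀ c₀ c₂ = refl
diamond-c₀ c₁ c₀ = refl
diamond-c₀ c₁ c₁ = refl
diamond-c₀ c₁ c₂ = refl
diamond-c₀ c₂ c₀ = refl
diamond-c₀ c₂ c₁ = refl
diamond-c₀ c₂ c₂ = refl

diamond-c₁ : ∀ t u → ¬ (t ≡ c₀ × u ≡ c₀) → mex₂ (mex₂ t c₁) (mex₂ c₁ u) ≡ c₁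
diamond-c₁ c₀ c₀ not-both = ⊥-elim (not-both (refl , refl))
diamond-c₁ c₀ c₁ _ = refl
diamond-c₁ c₀ c₂ _ = refl
diamond-c₁ c₁ c₀ _ = refl
diamond-c₁ c₁ c₁ _ = refl
diamond-c₁ c₁ c₂ _ = refl
diamond-c₁ c₂ c₀ _ = refl
diamond-c₁ c₂ c₁ _ = refl
diamond-c₁ c₂ c₂ _ = refl

-- The class-level core of diagonal-step: p is the class of (x, y), r₁ and r₂ those of its transfer
-- options, and t and u those of the other transfer options of the two middle positions of the diamond.
diamond : ∀ {p} r₁ r₂ t u → p ≡ mex₂ r₁ r₂ →
          ¬ (t ≡ c₂ × p ≡ c₂) → ¬ (p ≡ c₂ × u ≡ c₂) →
          (t ≡ r₁ → r₁ ≡ c₂) → (u ≡ r₂ → r₂ ≡ c₂) →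
          mex₂ (mex₂ t p) (mex₂ p u) ≡ p
diamond c₁ c₁ t u refl _ _ _ _ = diamond-c₀ t u
diamond c₁ c₂ t u refl _ _ _ _ = diamond-c₀ t u
diamond c₂ c₁ t u refl _ _ _ _ = diamond-c₀ t u
diamond c₂ c₂ t u refl _ _ _ _ = diamond-c₀ t u
diamond c₀ c₀ t u refl _ _ t≡r₁⇒ _ = diamond-c₁ t u λ (t≡c₀ , _) → c₀≢c₂ (t≡r₁⇒ t≡c₀)
diamond c₀ c₂ t u refl _ _ t≡r₁⇒ _ = diamond-c₁ t u λ (t≡c₀ , _) → c₀≢c₂ (t≡r₁⇒ t≡c₀)
diamond c₂ c₀ t u refl _ _ _ u≡r₂⇒ = diamond-c₁ t u λ (_ , u≡c₀) → c₀≢c₂ (u≡r₂⇒ u≡c₀)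
diamond c₀ c₁ c₁ c₀ refl _ _ _ _ = refl
diamond c₀ c₁ c₀ _  refl _ _ t≡r₁⇒ _ = ⊥-elim (c₀≢c₂ (t≡r₁⇒ refl))
diamond c₀ c₁ c₂ _  refl ¬t∧p _ _ _ = ⊥-elim (¬t∧p (refl , refl))
diamond c₀ c₁ c₁ c₁ refl _ _ _ u≡r₂⇒ = ⊥-elim (c₁≢c₂ (u≡r₂⇒ refl))
diamond c₀ c₁ c₁ c₂ refl _ ¬p∧u _ _ = ⊥-elim (¬p∧u (refl , refl))
diamond c₁ c₀ c₀ c₁ refl _ _ _ _ = refl
diamond c₁ c₀ c₁ _  refl _ _ t≡r₁⇒ _ = ⊥-elim (c₁≢c₂ (t≡r₁⇒ refl))
diamond c₁ c₀ c₂ _  refl ¬t∧p _ _ _ = ⊥-elim (¬t∧p (refl , refl))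
diamond c₁ c₀ c₀ c₀ refl _ _ _ u≡r₂⇒ = ⊥-elim (c₀≢c₂ (u≡r₂⇒ refl))
diamond c₁ c₀ c₀ c₂ refl _ ¬p∧u _ _ = ⊥-elim (¬p∧u (refl , refl))

mexFrom≤ : ∀ f k l → mexFrom f k l ≤ k + f
mexFrom≤ zero    k l = m≤m+n k 0
mexFrom≤ (suc f) k l with any (_≡ᵇ k) l
... | true  = subst (mexFrom f (suc k) l ≤_) (sym (+-suc k f)) (mexFrom≤ f (suc k) l)
... | false = m≤m+n k (suc f)

mex≤length : ∀ l → mex l ≤ length l
mex≤length l = mexFrom≤ (length l) 0 l

mexFrom≥ : ∀ f k l → k ≤ mexFrom f k l
mexFrom≥ zero    k l = ≤-refl
mexFrom≥ (suc f) k l with any (_≡ᵇ k) l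
... | true  = ≤-trans (n≤1+n k) (mexFrom≥ f (suc k) l)
... | false = ≤-refl

class-≥2 : ∀ {n} → 2 ≤ n → class n ≡ c₂
class-≥2 (s≤s (s≤s _)) = refl

class-==-c₀ : ∀ v → (class v == c₀) ≡ (v ≡ᵇ 0)
class-==-c₀ zero          = refl
class-==-c₀ (suc zero)    = refl
class-==-c₀ (suc (suc _)) = refl

class-==-c₁ : ∀ v → (class v == c₁) ≡ (v ≡ᵇ 1)
class-==-c₁ zero          = refl
class-==-c₁ (suc zero)    = refl
class-==-c₁ (suc (suc _)) = refl

occurs-map-class : ∀ c n → (∀ v → (class v == c) ≡ (v ≡ᵇ n)) →
                   ∀ l → occurs c (map class l) ≡ any (_≡ᵇ n) l
occurs-map-class c n class-==-c l = cong or (trans (sym (map-∘ l)) (map-cong class-==-c l))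

class-mex : ∀ l → class (mex l) ≡ mexᶜ (map class l)
class-mex l rewrite occurs-map-class c₀ 0 class-==-c₀ l | occurs-map-class c₁ 1 class-==-c₁ l =
  class-mex-≡ᵇ l
  where
  -- For lists of length ≥ 2, mexFrom is not cut short before it has tested both 0 and 1.
  class-mex-≡ᵇ : ∀ l → class (mex l) ≡ mexᵇ (any (_≡ᵇ 0) l) (any (_≡ᵇ 1) l)
  class-mex-≡ᵇ []                 = refl
  class-mex-≡ᵇ (zero ∷ [])        = refl
  class-mex-≡ᵇ (suc zero ∷ [])    = refl
  class-mex-≡ᵇ (suc (suc _) ∷ []) = refl
  class-mex-≡ᵇ l@(_ ∷ _ ∷ l′) with any (_≡ᵇ 0) l | any (_≡ᵇ 1) l
  ... | false | _     = refl
  ... | true  | false = refl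
  ... | true  | true  = class-≥2 (mexFrom≥ (length l′) 2 l)

-- SG is defined by <-rec, whose unfolding exposes the accessibility proofs of the recursive calls;
-- they must be rewritten to the canonical ones before SG reappears definitionally.
∸-acc-canonical : ∀ {m n} (0<n : 0 < n) (n≤m : n ≤ m) →
                  <′-wellFounded′ m (<⇒<′ (∸-monoʳ-< 0<n n≤m)) ≡ <′-wellFounded (m ∸ n)
∸-acc-canonical 0<n n≤m = canonical (<⇒<′ (∸-monoʳ-< 0<n n≤m))
  where
  canonical : ∀ {m n} (m<n : m <′ n) → <′-wellFounded′ n m<n ≡ <′-wellFounded m
  canonical ≤′-refl        = refl
  canonical (≤′-step m<n) = canonical m<n

module Game (G : Lengyel) where
  open Lengyel G

  verticalOption : ℕ → ℕ → List ℕ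
  verticalOption x y with b ≤? y
  ... | yes _ = SG G x (y ∸ b) ∷ []
  ... | no  _ = []

  transferOption : (dx dy x y : ℕ) → List ℕ
  transferOption dx dy x y with dx ≤? x
  ... | yes _ = SG G (x ∸ dx) (y + dy) ∷ []
  ... | no  _ = []

  transferOptions : ℕ → ℕ → List ℕ
  transferOptions x y = transferOption x₁ y₁ x y ++ transferOption x₂ y₂ x y

  SG-unfold : ∀ x y → SG G x y ≡ mex (verticalOption x y ++ transferOptions x y)
  SG-unfold x y with b ≤? y
  SG-unfold x y | yes b≤y with x₁ ≤? x
  SG-unfold x y | yes b≤y | yes x₁≤x with x₂ ≤? x
  SG-unfold x y | yes b≤y | yes x₁≤x | yes x₂≤x
    rewrite ∸-acc-canonical b>0 b≤y | ∸-acc-canonical x₁>0 x₁≤x | ∸-acc-canonical x₂>0 x₂≤x = refl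
  SG-unfold x y | yes b≤y | yes x₁≤x | no _
    rewrite ∸-acc-canonical b>0 b≤y | ∸-acc-canonical x₁>0 x₁≤x = refl
  SG-unfold x y | yes b≤y | no _ with x₂ ≤? x
  SG-unfold x y | yes b≤y | no _ | yes x₂≤x
    rewrite ∸-acc-canonical b>0 b≤y | ∸-acc-canonical x₂>0 x₂≤x = refl
  SG-unfold x y | yes b≤y | no _ | no _
    rewrite ∸-acc-canonical b>0 b≤y = refl
  SG-unfold x y | no _ with x₁ ≤? x
  SG-unfold x y | no _ | yes x₁≤x with x₂ ≤? x
  SG-unfold x y | no _ | yes x₁≤x | yes x₂≤x
    rewrite ∸-acc-canonical x₁>0 x₁≤x | ∸-acc-canonical x₂>0 x₂≤x = refl
  SG-unfold x y | no _ | yes x₁≤x | no _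
    rewrite ∸-acc-canonical x₁>0 x₁≤x = refl
  SG-unfold x y | no _ | no _ with x₂ ≤? x
  SG-unfold x y | no _ | no _ | yes x₂≤x
    rewrite ∸-acc-canonical x₂>0 x₂≤x = refl
  SG-unfold x y | no _ | no _ | no _ = refl

  length-verticalOption : ∀ x y → length (verticalOption x y) ≤ 1
  length-verticalOption x y with b ≤? y
  ... | yes _ = ≤-refl
  ... | no  _ = z≤n

  length-transferOption : ∀ dx dy x y → length (transferOption dx dy x y) ≤ 1
  length-transferOption dx dy x y with dx ≤? x
  ... | yes _ = ≤-refl
  ... | no  _ = z≤n

  SG≤3 : ∀ x y → SG G x y ≤ 3
  SG≤3 x y = begin
    SG G x y                            ≡⟨ SG-unfold x y ⟩
    mex (V ++ T₁ ++ T₂)                 ≤⟨ mex≤length (V ++ T₁ ++ T₂) ⟩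
    length (V ++ T₁ ++ T₂)              ≡⟨ trans (length-++ V) (cong (length V +_) (length-++ T₁)) ⟩
    length V + (length T₁ + length T₂)  ≤⟨ +-mono-≤ (length-verticalOption x y)
                                             (+-mono-≤ (length-transferOption x₁ y₁ x y)
                                                       (length-transferOption x₂ y₂ x y)) ⟩
    3                                   ∎
    where
    open ≤-Reasoning
    V T₁ T₂ : List ℕ
    V  = verticalOption x y
    T₁ = transferOption x₁ y₁ x y
    T₂ = transferOption x₂ y₂ x y

  SGᶜ : ℕ → ℕ → Class
  SGᶜ x y = class (SG G x y)

  SG*≡value-SGᶜ : ∀ x y → SG* G x y ≡ value (SGᶜ x y)
  SG*≡value-SGᶜ x y = capped (SG G x y) (SG≤3 x y)
    where
    capped : ∀ n → n ≤ 3 → (if n ≡ᵇ 3 then 2 else n) ≡ value (class n)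
    capped 0 _ = refl
    capped 1 _ = refl
    capped 2 _ = refl
    capped 3 _ = refl
    capped (suc (suc (suc (suc _)))) (s≤s (s≤s (s≤s ())))

  verticalᶜ : ℕ → ℕ → List Class
  verticalᶜ x y = map class (verticalOption x y)

  transferᶜ : (dx dy x y : ℕ) → List Class
  transferᶜ dx dy x y = map class (transferOption dx dy x y)

  transfersᶜ : ℕ → ℕ → List Class
  transfersᶜ x y = transferᶜ x₁ y₁ x y ++ transferᶜ x₂ y₂ x y

  SGᶜ-unfold : ∀ x y → SGᶜ x y ≡ mexᶜ (verticalᶜ x y ++ transfersᶜ x y)
  SGᶜ-unfold x y = begin
    class (SG G x y)                           ≡⟨ cong class (SG-unfold x y) ⟩
    class (mex (V ++ T₁ ++ T₂))                ≡⟨ class-mex (V ++ T₁ ++ T₂) ⟩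
    mexᶜ (map class (V ++ T₁ ++ T₂))           ≡⟨ cong mexᶜ (map-++ class V (T₁ ++ T₂)) ⟩
    mexᶜ (map class V ++ map class (T₁ ++ T₂)) ≡⟨ cong (λ T → mexᶜ (map class V ++ T)) (map-++ class T₁ T₂) ⟩
    mexᶜ (verticalᶜ x y ++ transfersᶜ x y)     ∎
    where
    open ≡-Reasoning
    V T₁ T₂ : List ℕ
    V  = verticalOption x y
    T₁ = transferOption x₁ y₁ x y
    T₂ = transferOption x₂ y₂ x y

  transferᶜ-available : ∀ {dx dy x y e} → e + dx ≡ x → transferᶜ dx dy x y ≡ SGᶜ e (y + dy) ∷ []
  transferᶜ-available {dx} {dy} {x} {y} {e} e+dx≡x with dx ≤? x
  ... | yes _    = cong (λ e′ → SGᶜ e′ (y + dy) ∷ []) (trans (cong (_∸ dx) (sym e+dx≡x)) (m+n∸n≡m e dx))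
  ... | no  dx≰x = ⊥-elim (dx≰x (subst (dx ≤_) e+dx≡x (m≤n+m dx e)))

  ∈-transferᶜ : ∀ {dx dy x y e} → e + dx ≡ x → SGᶜ e (y + dy) ∈ transferᶜ dx dy x y
  ∈-transferᶜ e+dx≡x = subst (_ ∈_) (sym (transferᶜ-available e+dx≡x)) (here refl)

  SGᶜ-transfer-c₂ : ∀ {x y r} → r ∈ transfersᶜ x y → SGᶜ x y ≡ r → r ≡ c₂
  SGᶜ-transfer-c₂ {x} {y} r∈T SGᶜ≡r =
    mexᶜ-∉ (∈-++⁺ʳ (verticalᶜ x y) r∈T) (trans (sym (SGᶜ-unfold x y)) SGᶜ≡r)

  SGᶜ-transfer₁-c₂ : ∀ {x y e z} → e + x₁ ≡ x → y + y₁ ≡ z → SGᶜ x y ≡ SGᶜ e z → SGᶜ e z ≡ c₂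
  SGᶜ-transfer₁-c₂ refl refl = SGᶜ-transfer-c₂ (∈-++⁺ˡ (∈-transferᶜ {x₁} {y₁} refl))

  SGᶜ-transfer₂-c₂ : ∀ {x y e z} → e + x₂ ≡ x → y + y₂ ≡ z → SGᶜ x y ≡ SGᶜ e z → SGᶜ e z ≡ c₂
  SGᶜ-transfer₂-c₂ {y = y} {e} refl refl =
    SGᶜ-transfer-c₂ (∈-++⁺ʳ (transferᶜ x₁ y₁ (e + x₂) y) (∈-transferᶜ {x₂} {y₂} refl))

  Swaps : ℕ → ℕ → Set
  Swaps x y = SGᶜ x (y + b) ≡ swap₀₁ (SGᶜ x y)

  SwapsBelow : ℕ → ℕ → Set
  SwapsBelow x y = ∀ {y′} → y′ < y → Swaps x y′

  SwapsLeftOf : ℕ → Set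
  SwapsLeftOf x = ∀ {x′} → x′ < x → ∀ y → Swaps x′ y

  verticalᶜ-+b : ∀ x y → verticalᶜ x (y + b) ≡ SGᶜ x y ∷ []
  verticalᶜ-+b x y with b ≤? y + b
  ... | yes _     = cong (λ y′ → SGᶜ x y′ ∷ []) (m+n∸n≡m y b)
  ... | no  b≰y+b = ⊥-elim (b≰y+b (m≤n+m b y))

  verticalᶜ-≤ : ∀ {x y} → b ≤ y → verticalᶜ x y ≡ SGᶜ x (y ∸ b) ∷ []
  verticalᶜ-≤ {x} {y} b≤y with b ≤? y
  ... | yes _   = refl
  ... | no  b≰y = ⊥-elim (b≰y b≤y)

  verticalᶜ-≰ : ∀ {x y} → ¬ b ≤ y → verticalᶜ x y ≡ []
  verticalᶜ-≰ {x} {y} b≰y with b ≤? y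
  ... | yes b≤y = ⊥-elim (b≰y b≤y)
  ... | no  _   = refl

  -- A plain `with b ≤? y` would also abstract the decision inside the unfolding of SGᶜ x y.
  verticalᶜ-swap₀₁ : ∀ {x y} → SwapsBelow x y →
                     verticalᶜ x y ≡ [] ⊎ verticalᶜ x y ≡ swap₀₁ (SGᶜ x y) ∷ []
  verticalᶜ-swap₀₁ {x} {y} IH = by-cases (b ≤? y)
    where
    open ≡-Reasoning
    by-cases : Dec (b ≤ y) → verticalᶜ x y ≡ [] ⊎ verticalᶜ x y ≡ swap₀₁ (SGᶜ x y) ∷ []
    by-cases (no  b≰y) = inj₁ (verticalᶜ-≰ b≰y)
    by-cases (yes b≤y) = inj₂ (trans (verticalᶜ-≤ b≤y) (cong (_∷ []) (begin
      SGᶜ x (y ∸ b)                    ≡⟨ sym (swap₀₁-involutive _) ⟩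
      swap₀₁ (swap₀₁ (SGᶜ x (y ∸ b)))  ≡⟨ cong swap₀₁ (sym (IH (∸-monoʳ-< {y} {b} {0} b>0 b≤y))) ⟩
      swap₀₁ (SGᶜ x (y ∸ b + b))       ≡⟨ cong (λ y′ → swap₀₁ (SGᶜ x y′)) (m∸n+n≡m b≤y) ⟩
      swap₀₁ (SGᶜ x y)                 ∎)))

  SGᶜ-swap₀₁-option : ∀ {x y} → SwapsBelow x y → SGᶜ x y ≡ mexᶜ (swap₀₁ (SGᶜ x y) ∷ transfersᶜ x y)
  SGᶜ-swap₀₁-option {x} {y} IH =
    [ (λ V≡[] → mexᶜ-cons-swap₀₁ _ (transfersᶜ x y) (unfold-with V≡[])) , unfold-with ]
      (verticalᶜ-swap₀₁ IH)
    where
    unfold-with : ∀ {V} → verticalᶜ x y ≡ V → SGᶜ x y ≡ mexᶜ (V ++ transfersᶜ x y)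
    unfold-with V≡ = trans (SGᶜ-unfold x y) (cong (λ V → mexᶜ (V ++ transfersᶜ x y)) V≡)

  transferᶜ-+b : ∀ {dx dy x y} → 0 < dx → SwapsLeftOf x →
                 transferᶜ dx dy x (y + b) ≡ map swap₀₁ (transferᶜ dx dy x y)
  transferᶜ-+b {dx} {dy} {x} {y} 0<dx IH with dx ≤? x
  ... | yes dx≤x = cong (_∷ []) (trans (cong (SGᶜ (x ∸ dx)) (xy∙z≈xz∙y y b dy))
                                       (IH (∸-monoʳ-< 0<dx dx≤x) (y + dy)))
  ... | no  _    = refl

  transfersᶜ-+b : ∀ {x y} → SwapsLeftOf x → transfersᶜ x (y + b) ≡ map swap₀₁ (transfersᶜ x y)
  transfersᶜ-+b {x} {y} IH =
    trans (cong₂ _++_ (transferᶜ-+b x₁>0 IH) (transferᶜ-+b x₂>0 IH))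
          (sym (map-++ swap₀₁ (transferᶜ x₁ y₁ x y) (transferᶜ x₂ y₂ x y)))

  SGᶜ-+b : ∀ x y → Swaps x y
  SGᶜ-+b = <-rec (λ x → ∀ y → Swaps x y) λ x IHx → <-rec (Swaps x) λ y IHy → begin
    SGᶜ x (y + b)                                       ≡⟨ SGᶜ-unfold x (y + b) ⟩
    mexᶜ (verticalᶜ x (y + b) ++ transfersᶜ x (y + b))  ≡⟨ cong₂ (λ V T → mexᶜ (V ++ T))
                                                               (verticalᶜ-+b x y) (transfersᶜ-+b IHx) ⟩
    mexᶜ (SGᶜ x y ∷ map swap₀₁ (transfersᶜ x y))        ≡⟨ mexᶜ-swap₀₁ _ (transfersᶜ x y) (SGᶜ-swap₀₁-option IHy) ⟩
    swap₀₁ (SGᶜ x y)                                    ∎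
    where open ≡-Reasoning

  SGᶜ-transfer-rule : ∀ {x y e₁ e₂} → e₁ + x₁ ≡ x → e₂ + x₂ ≡ x →
                      ¬ (SGᶜ e₁ (y + y₁) ≡ c₂ × SGᶜ e₂ (y + y₂) ≡ c₂) →
                      SGᶜ x y ≡ mex₂ (SGᶜ e₁ (y + y₁)) (SGᶜ e₂ (y + y₂))
  SGᶜ-transfer-rule {x} {y} e₁+x₁≡x e₂+x₂≡x not-both = mex₂-ignores-swap₀₁ _ _ _ not-both (begin
    SGᶜ x y                                                          ≡⟨ SGᶜ-swap₀₁-option (λ _ → SGᶜ-+b x _) ⟩
    mexᶜ (swap₀₁ (SGᶜ x y) ∷ transfersᶜ x y)                         ≡⟨ cong (λ T → mexᶜ (swap₀₁ (SGᶜ x y) ∷ T))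
                                                                          transfers ⟩
    mexᶜ (swap₀₁ (SGᶜ x y) ∷ SGᶜ _ (y + y₁) ∷ SGᶜ _ (y + y₂) ∷ [])   ∎)
    where
    open ≡-Reasoning
    transfers : transfersᶜ x y ≡ SGᶜ _ (y + y₁) ∷ SGᶜ _ (y + y₂) ∷ []
    transfers = cong₂ _++_ (transferᶜ-available e₁+x₁≡x) (transferᶜ-available e₂+x₂≡x)

module NoBadPairs (G : Lengyel) (x₀ : ℕ)
  (no-bad-pair : ∀ x y x′ y′ → x₀ ≤ x → x₀ ≤ x′ → ¬ BadPair G x y x′ y′) where
  open Lengyel G
  open Game G

  transfer-rule : ∀ {x y e₁ e₂ z₁ z₂} → x₀ ≤ e₁ → x₀ ≤ e₂ → e₁ + x₁ ≡ x → e₂ + x₂ ≡ x →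
                  y + y₁ ≡ z₁ → y + y₂ ≡ z₂ →
                  SGᶜ x y ≡ mex₂ (SGᶜ e₁ z₁) (SGᶜ e₂ z₂) × ¬ (SGᶜ e₁ z₁ ≡ c₂ × SGᶜ e₂ z₂ ≡ c₂)
  transfer-rule {y = y} {e₁} {e₂} x₀≤e₁ x₀≤e₂ e₁+x₁≡x e₂+x₂≡x refl refl =
    SGᶜ-transfer-rule e₁+x₁≡x e₂+x₂≡x not-both , not-both
    where
    SG*≡2 : ∀ {u v} → SGᶜ u v ≡ c₂ → SG* G u v ≡ 2
    SG*≡2 {u} {v} SGᶜ≡c₂ = trans (SG*≡value-SGᶜ u v) (cong value SGᶜ≡c₂)
    not-both : ¬ (SGᶜ e₁ (y + y₁) ≡ c₂ × SGᶜ e₂ (y + y₂) ≡ c₂)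
    not-both (r₁≡c₂ , r₂≡c₂) = no-bad-pair _ _ _ _ x₀≤e₂ x₀≤e₁
      (SG*≡2 r₂≡c₂ , SG*≡2 r₁≡c₂ , trans e₂+x₂≡x (sym e₁+x₁≡x) , xy∙z≈xz∙y y y₂ y₁)

  diagonal-step : ∀ {x e₁ e₂} k → x₀ ≤ e₁ → x₀ ≤ e₂ → e₁ + x₁ ≡ x → e₂ + x₂ ≡ x →
                  SGᶜ (x + x₁ + x₂) k ≡ SGᶜ x (k + y₁ + y₂)
  diagonal-step {x} {e₁} {e₂} k x₀≤e₁ x₀≤e₂ e₁+x₁≡x e₂+x₂≡x = begin
    SGᶜ (x + x₁ + x₂) k                                   ≡⟨ proj₁ at-q ⟩
    mex₂ (SGᶜ (x + x₂) (k + y₁)) (SGᶜ (x + x₁) (k + y₂))  ≡⟨ cong₂ mex₂ (proj₁ at-a₁) (proj₁ at-a₂) ⟩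
    mex₂ (mex₂ t p) (mex₂ p u)                            ≡⟨ diamond r₁ r₂ t u (proj₁ at-p)
                                                               (proj₂ at-a₁) (proj₂ at-a₂) t≡r₁⇒ u≡r₂⇒ ⟩
    p                                                     ∎
    where
    open ≡-Reasoning
    y : ℕ
    y = k + y₁ + y₂
    p r₁ r₂ t u : Class
    p  = SGᶜ x y
    r₁ = SGᶜ e₁ (y + y₁)
    r₂ = SGᶜ e₂ (y + y₂)
    t  = SGᶜ (e₁ + x₂) (k + y₁ + y₁)
    u  = SGᶜ (e₂ + x₁) (k + y₂ + y₂)
    x₀≤x : x₀ ≤ x
    x₀≤x = ≤-trans x₀≤e₁ (subst (e₁ ≤_) e₁+x₁≡x (m≤m+n e₁ x₁))
    at-p : p ≡ mex₂ r₁ r₂ × ¬ (r₁ ≡ c₂ × r₂ ≡ c₂)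
    at-p = transfer-rule x₀≤e₁ x₀≤e₂ e₁+x₁≡x e₂+x₂≡x refl refl
    at-a₁ : SGᶜ (x + x₂) (k + y₁) ≡ mex₂ t p × ¬ (t ≡ c₂ × p ≡ c₂)
    at-a₁ = transfer-rule (≤-trans x₀≤e₁ (m≤m+n e₁ x₂)) x₀≤x
              (trans (xy∙z≈xz∙y e₁ x₂ x₁) (cong (_+ x₂) e₁+x₁≡x)) refl refl refl
    at-a₂ : SGᶜ (x + x₁) (k + y₂) ≡ mex₂ p u × ¬ (p ≡ c₂ × u ≡ c₂)
    at-a₂ = transfer-rule x₀≤x (≤-trans x₀≤e₂ (m≤m+n e₂ x₁))
              refl (trans (xy∙z≈xz∙y e₂ x₁ x₂) (cong (_+ x₁) e₂+x₂≡x)) (xy∙z≈xz∙y k y₂ y₁) refl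
    at-q : SGᶜ (x + x₁ + x₂) k ≡ mex₂ (SGᶜ (x + x₂) (k + y₁)) (SGᶜ (x + x₁) (k + y₂))
           × ¬ (SGᶜ (x + x₂) (k + y₁) ≡ c₂ × SGᶜ (x + x₁) (k + y₂) ≡ c₂)
    at-q = transfer-rule (≤-trans x₀≤x (m≤m+n x x₂)) (≤-trans x₀≤x (m≤m+n x x₁))
             (xy∙z≈xz∙y x x₂ x₁) refl refl refl
    t≡r₁⇒ : t ≡ r₁ → r₁ ≡ c₂
    t≡r₁⇒ = SGᶜ-transfer₂-c₂ refl (xy∙z≈xz∙y (k + y₁) y₁ y₂)
    u≡r₂⇒ : u ≡ r₂ → r₂ ≡ c₂
    u≡r₂⇒ = SGᶜ-transfer₁-c₂ refl (trans (xy∙z≈xz∙y (k + y₂) y₂ y₁) (cong (_+ y₂) (xy∙z≈xz∙y k y₂ y₁)))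

  SGᶜ-diagonal : ∀ {x} k → x₀ + (x₁ ⊔ x₂) ≤ x → SGᶜ (x + x₁ + x₂) k ≡ SGᶜ x (k + y₁ + y₂)
  SGᶜ-diagonal {x} k x₀+x₁⊔x₂≤x = diagonal-step k
    (x₀≤x∸ (m≤m⊔n x₁ x₂)) (x₀≤x∸ (m≤n⊔m x₁ x₂)) (x∸n+n≡x (m≤m⊔n x₁ x₂)) (x∸n+n≡x (m≤n⊔m x₁ x₂))
    where
    x₀+n≤x : ∀ {n} → n ≤ x₁ ⊔ x₂ → x₀ + n ≤ x
    x₀+n≤x n≤x₁⊔x₂ = ≤-trans (+-monoʳ-≤ x₀ n≤x₁⊔x₂) x₀+x₁⊔x₂≤x
    x₀≤x∸ : ∀ {n} → n ≤ x₁ ⊔ x₂ → x₀ ≤ x ∸ n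
    x₀≤x∸ = m+n≤o⇒m≤o∸n x₀ ∘ x₀+n≤x
    x∸n+n≡x : ∀ {n} → n ≤ x₁ ⊔ x₂ → x ∸ n + n ≡ x
    x∸n+n≡x = m∸n+n≡m ∘ m+n≤o⇒n≤o x₀ ∘ x₀+n≤x

mainTheorem18 : (G : Lengyel) (x₀ : ℕ) →
    (∀ x y x' y' → x₀ ≤ x → x₀ ≤ x' → ¬ BadPair G x y x' y') →
    DiagPeriodicAfter G (x₀ + (Lengyel.x₁ G ⊔ Lengyel.x₂ G))
mainTheorem18 G x₀ no-bad-pair x y x₀+x₁⊔x₂≤x y₁+y₂≤y = begin
  SG* G x y                    ≡⟨ SG*≡value-SGᶜ x y ⟩
  value (SGᶜ x y)              ≡⟨ cong (value ∘ SGᶜ x) y≡k+y₁+y₂ ⟩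
  value (SGᶜ x (k + y₁ + y₂))  ≡⟨ cong value (sym (SGᶜ-diagonal k x₀+x₁⊔x₂≤x)) ⟩
  value (SGᶜ (x + x₁ + x₂) k)  ≡⟨ sym (SG*≡value-SGᶜ (x + x₁ + x₂) k) ⟩
  SG* G (x + x₁ + x₂) k        ∎
  where
  open Lengyel G
  open Game G
  open NoBadPairs G x₀ no-bad-pair
  open ≡-Reasoning
  k : ℕ
  k = y ∸ (y₁ + y₂)
  y≡k+y₁+y₂ : y ≡ k + y₁ + y₂
  y≡k+y₁+y₂ = trans (sym (m∸n+n≡m y₁+y₂≤y)) (sym (+-assoc k y₁ y₂))
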